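{- Let $d\ge3$, $n>d$ and $2\le k\le n$. Put $r_k=\lfloor n^{d-1}(n-1)^{k+1-2^k}\rfloor$. Then every $d$-dimensional latin hypercube $Q$ of order $n$ contains at least $\binom{d}{k}\,n\,(n-d)^{2^k-1}\,r_k(r_k-1)$ non-degenerate $k$-dimensional cuboctahedra.
   Context: A $d$-dimensional latin hypercube of order $n$ is an array $Q=(q_\alpha)$ indexed by $\alpha\in\{0,\ldots,n-1\}^d$ with entries in $\{0,\ldots,n-1\}$ such that any two indices differing in exactly one coordinate carry different symbols. A cuboctahedron in $Q$ is a tuple consisting of $d$ ordered pairs $(a^i_1,a^i_2)$ and $d$ ordered pairs $(b^i_1,b^i_2)$, $i=1,\ldots,d$, of elements of $\{0,\ldots,n-1\}$, such that $q_{a^1_{j_1},\ldots,a^d_{j_d}}=q_{b^1_{j_1},\ldots,b^d_{j_d}}$ for all $j_1,\ldots,j_d\in\{1,2\}$; cuboctahedra are counted as such tuples. It has dimension $k$ if exactly $k$ indices $i$ satisfy $a^i_1\ne a^i_2$. It is degenerate if $a^i_j=b^i_j$ for all $i,j$, and non-degenerate otherwise. The binomial coefficient $\binom{d}{k}$ is $0$ when $k>d$. -}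

module Defs where

open import Data.Nat using (ℕ; zero; suc; _+_; _*_; _∸_; _^_; _/_)
open import Data.Fin using (Fin; _≟_)
open import Data.Bool using (Bool; true; false)
open import Data.Product using (_×_; _,_; proj₁; proj₂; ∃-syntax)
open import Data.Vec using (Vec; lookup; zipWith; count)
open import Relation.Binary.PropositionalEquality using (_≡_; _≢_)
open import Relation.Nullary using (¬_; ¬?)

Index : ℕ → ℕ → Set
Index d n = Vec (Fin n) d

Array : ℕ → ℕ → Set
Array d n = Index d n → Fin n

DifferInExactlyOne : ∀ {d n} → Index d n → Index d n → Set
DifferInExactlyOne {d} α β =
  ∃[ i ] (lookup α i ≢ lookup β i × (∀ j → j ≢ i → lookup α j ≡ lookup β j))

IsLatinHypercube : ∀ {d n} → Array d n → Set
IsLatinHypercube {d} {n} Q =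
  ∀ (α β : Index d n) → DifferInExactlyOne α β → Q α ≢ Q β

Pairs : ℕ → ℕ → Set
Pairs d n = Vec (Fin n × Fin n) d

CuboTuple : ℕ → ℕ → Set
CuboTuple d n = Pairs d n × Pairs d n

pick : ∀ {n} → Fin n × Fin n → Bool → Fin n
pick (x , y) false = x
pick (x , y) true  = y

select : ∀ {d n} → Pairs d n → Vec Bool d → Index d n
select a js = zipWith pick a js

IsCuboctahedron : ∀ {d n} → Array d n → CuboTuple d n → Set
IsCuboctahedron {d} Q (a , b) =
  ∀ (js : Vec Bool d) → Q (select a js) ≡ Q (select b js)

dimension : ∀ {d n} → CuboTuple d n → ℕ
dimension (a , b) = count (λ p → ¬? (proj₁ p ≟ proj₂ p)) a

IsDegenerate : ∀ {d n} → CuboTuple d n → Set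
IsDegenerate (a , b) = a ≡ b

IsNonDegCuboOfDim : ∀ {d n} → Array d n → ℕ → CuboTuple d n → Set
IsNonDegCuboOfDim Q k c =
  IsCuboctahedron Q c × dimension c ≡ k × ¬ IsDegenerate c

-- natural division with the (irrelevant here) convention m / 0 = 0
_div_ : ℕ → ℕ → ℕ
m div zero = 0
m div suc q = m / suc q

-- r_k = ⌊ n^(d-1) (n-1)^(k+1-2^k) ⌋ = ⌊ n^(d-1) / (n-1)^(2^k-k-1) ⌋  (for k ≥ 2, n ≥ 2)
r : ℕ → ℕ → ℕ → ℕ
r d n k = (n ^ (d ∸ 1)) div ((n ∸ 1) ^ ((2 ^ k) ∸ (k + 1)))

module Submission where

-- A family a of d pairs with k active directions spans a k-dimensional subcube, on which a latin
-- hypercube Q restricts to a proper colouring of the k-cube. Such a colouring is determined by its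
-- direction set, its value at one vertex (n choices) and the value of each of the other 2ᵏ - 1
-- vertices relative to a neighbour (n - 1 choices), so two families with equal keys of this kind
-- form a cuboctahedron. There are |L| = C(d,k) nᵈ (n-1)ᵏ families and |E| = C(d,k) n (n-1)^(2ᵏ-1)
-- keys; Cauchy–Schwarz over the fibres of the key map gives at least |L|²/|E| - |L| ordered pairs
-- of distinct families with a common key, and |L| ≥ r_k |E|.

open import Defs
open import Data.Bool using (Bool; true; false; if_then_else_)
open import Data.Bool.Properties using (T?) renaming (_≟_ to _≟ᵇ_)
open import Data.Empty using (⊥-elim)
open import Data.Fin using (Fin; zero; suc; punchOut) renaming (_≟_ to _≟ᶠ_)
open import Data.Fin.Properties using (punchOut-injective)
open import Data.List
  using (List; []; _∷_; [_]; length; map; _++_; filter; cartesianProductWith; cartesianProduct; allFin)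
open import Data.List.Membership.Propositional using (_∈_)
open import Data.List.Membership.Propositional.Properties
  using (∈-filter⁺; ∈-filter⁻; ∈-cartesianProduct⁺; ∈-cartesianProduct⁻; ∈-cartesianProductWith⁺; ∈-allFin)
import Data.List.Properties as List
open import Data.List.Relation.Unary.All as All using (All)
open import Data.List.Relation.Unary.Any using (here; there)
open import Data.List.Relation.Unary.Unique.Propositional using (Unique; []; _∷_)
open import Data.List.Relation.Unary.Unique.Propositional.Properties
  using (cartesianProductWith⁺; cartesianProduct⁺; filter⁺; allFin⁺)
open import Data.Nat
  using (ℕ; zero; suc; _+_; _*_; _∸_; _^_; _≤_; _<_; z≤n; s≤s) renaming (_≟_ to _≟ⁿ_)
open import Data.Nat.Combinatorics using (_C_; nCk+nC[k+1]≡[n+1]C[k+1])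
open import Data.Nat.DivMod using (m/n*n≤m)
open import Data.Nat.Properties
open import Algebra.Properties.CommutativeSemigroup +-commutativeSemigroup
  using () renaming (interchange to +-interchange)
open import Data.Nat.Tactic.RingSolver using (solve-∀)
open import Data.Product using (Σ; _×_; _,_; proj₁; proj₂)
open import Data.Product.Properties using () renaming (≡-dec to ×-≡-dec)
open import Data.Unit using (⊤; tt)
open import Data.Vec using (Vec; []; _∷_; count; replicate; lookup)
import Data.Vec.Properties as Vec
open import Function using (_∘_)
open import Level using (Level)
open import Relation.Binary.Definitions using (DecidableEquality)
open import Relation.Binary.PropositionalEquality hiding ([_])
open import Relation.Nullary using (Dec; yes; no; does; ¬_; ¬?; _×-dec_)
open import Relation.Unary using (Pred; Decidable)

private variable
  a b c ℓ : Level
  A : Set a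
  B : Set b
  X : Set c

-- Sums over lists

𝟙 : {P : Set ℓ} → Dec P → ℕ
𝟙 D = if does D then 1 else 0

𝟙-+-𝟙-¬ : {P : Set ℓ} (D : Dec P) → 𝟙 D + 𝟙 (¬? D) ≡ 1
𝟙-+-𝟙-¬ (yes _) = refl
𝟙-+-𝟙-¬ (no  _) = refl

𝟙-*-𝟙 : {P : Set ℓ} (D : Dec P) → 𝟙 D * 𝟙 D ≡ 𝟙 D
𝟙-*-𝟙 (yes _) = refl
𝟙-*-𝟙 (no  _) = refl

𝟙-¬¬ : {P : Set ℓ} (D : Dec P) → 𝟙 (¬? (¬? D)) ≡ 𝟙 D
𝟙-¬¬ (yes _) = refl
𝟙-¬¬ (no  _) = refl

∑ : List A → (A → ℕ) → ℕ
∑ []       f = 0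
∑ (x ∷ xs) f = f x + ∑ xs f

syntax ∑ xs (λ x → e) = ∑[ x ∈ xs ] e

∑-cong : ∀ (xs : List A) {f g : A → ℕ} → (∀ {x} → x ∈ xs → f x ≡ g x) → ∑ xs f ≡ ∑ xs g
∑-cong []       f≗g = refl
∑-cong (x ∷ xs) f≗g = cong₂ _+_ (f≗g (here refl)) (∑-cong xs (f≗g ∘ there))

∑-mono : ∀ (xs : List A) {f g : A → ℕ} → (∀ x → f x ≤ g x) → ∑ xs f ≤ ∑ xs g
∑-mono []       f≤g = z≤n
∑-mono (x ∷ xs) f≤g = +-mono-≤ (f≤g x) (∑-mono xs f≤g)

∑-+ : ∀ (xs : List A) (f g : A → ℕ) → ∑[ x ∈ xs ] (f x + g x) ≡ ∑ xs f + ∑ xs g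
∑-+ []       f g = refl
∑-+ (x ∷ xs) f g = trans (cong (f x + g x +_) (∑-+ xs f g)) (+-interchange (f x) _ _ _)

∑-*ˡ : ∀ (xs : List A) (m : ℕ) (f : A → ℕ) → ∑[ x ∈ xs ] (m * f x) ≡ m * ∑ xs f
∑-*ˡ []       m f = sym (*-zeroʳ m)
∑-*ˡ (x ∷ xs) m f = trans (cong (m * f x +_) (∑-*ˡ xs m f)) (sym (*-distribˡ-+ m (f x) _))

∑-const : ∀ (xs : List A) (m : ℕ) → ∑[ x ∈ xs ] m ≡ length xs * m
∑-const []       m = refl
∑-const (x ∷ xs) m = cong (m +_) (∑-const xs m)

∑-++ : ∀ (xs ys : List A) (f : A → ℕ) → ∑ (xs ++ ys) f ≡ ∑ xs f + ∑ ys f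
∑-++ []       ys f = refl
∑-++ (x ∷ xs) ys f = trans (cong (f x +_) (∑-++ xs ys f)) (sym (+-assoc (f x) _ _))

∑-map : ∀ (h : A → B) (xs : List A) (f : B → ℕ) → ∑ (map h xs) f ≡ ∑ xs (f ∘ h)
∑-map h []       f = refl
∑-map h (x ∷ xs) f = cong (f (h x) +_) (∑-map h xs f)

∑-swap : ∀ (xs : List A) (ys : List B) (f : A → B → ℕ) →
         ∑[ x ∈ xs ] ∑[ y ∈ ys ] f x y ≡ ∑[ y ∈ ys ] ∑[ x ∈ xs ] f x y
∑-swap []       ys f = sym (trans (∑-const ys 0) (*-zeroʳ (length ys)))
∑-swap (x ∷ xs) ys f =
  trans (cong (∑ ys (f x) +_) (∑-swap xs ys f)) (sym (∑-+ ys (f x) (λ y → ∑[ x ∈ xs ] f x y)))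

∑-cartesianProductWith : ∀ (h : A → B → X) (xs : List A) (ys : List B) (f : X → ℕ) →
  ∑ (cartesianProductWith h xs ys) f ≡ ∑[ x ∈ xs ] ∑[ y ∈ ys ] f (h x y)
∑-cartesianProductWith h []       ys f = refl
∑-cartesianProductWith h (x ∷ xs) ys f = begin
  ∑ (map (h x) ys ++ cartesianProductWith h xs ys) f             ≡⟨ ∑-++ (map (h x) ys) _ f ⟩
  ∑ (map (h x) ys) f + ∑ (cartesianProductWith h xs ys) f        ≡⟨ cong₂ _+_ (∑-map (h x) ys f)
                                                                     (∑-cartesianProductWith h xs ys f) ⟩
  ∑[ y ∈ ys ] f (h x y) + ∑[ x ∈ xs ] ∑[ y ∈ ys ] f (h x y)      ∎
  where open ≡-Reasoning

length-filter≡∑𝟙 : {P : Pred A ℓ} (P? : Decidable P) (xs : List A) →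
  length (filter P? xs) ≡ ∑[ x ∈ xs ] 𝟙 (P? x)
length-filter≡∑𝟙 P? []       = refl
length-filter≡∑𝟙 P? (x ∷ xs) with P? x
... | yes _ = cong suc (length-filter≡∑𝟙 P? xs)
... | no  _ = length-filter≡∑𝟙 P? xs

module _ (_≟_ : DecidableEquality A) where

  ∑-𝟙-≟-absent : ∀ {x} {ys : List A} → All (λ y → ¬ x ≡ y) ys → ∑[ y ∈ ys ] 𝟙 (x ≟ y) ≡ 0
  ∑-𝟙-≟-absent All.[] = refl
  ∑-𝟙-≟-absent {x} {y ∷ _} (x≢y All.∷ x∉ys) with x ≟ y
  ... | yes x≡y = ⊥-elim (x≢y x≡y)
  ... | no  _   = ∑-𝟙-≟-absent x∉ys

  ∑-𝟙-≟-unique : ∀ {x} {ys : List A} → Unique ys → x ∈ ys → ∑[ y ∈ ys ] 𝟙 (x ≟ y) ≡ 1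
  ∑-𝟙-≟-unique {x} (y∉ys ∷ _) (here refl) with x ≟ x
  ... | yes _   = cong suc (∑-𝟙-≟-absent y∉ys)
  ... | no  x≢x = ⊥-elim (x≢x refl)
  ∑-𝟙-≟-unique {x} {y ∷ _} (y∉ys ∷ u) (there x∈ys) with x ≟ y
  ... | no  _   = ∑-𝟙-≟-unique u x∈ys
  ... | yes refl = ⊥-elim (All.lookup y∉ys x∈ys refl)

  𝟙-≟-*-𝟙-≟-≢ : ∀ {u v} → ¬ u ≡ v → ∀ w → 𝟙 (u ≟ w) * 𝟙 (v ≟ w) ≡ 0
  𝟙-≟-*-𝟙-≟-≢ {u} {v} u≢v w with u ≟ w | v ≟ w
  ... | yes refl | yes refl = ⊥-elim (u≢v refl)
  ... | yes _    | no  _    = refl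
  ... | no  _    | _        = refl

  ∑-𝟙-≟-*-𝟙-≟ : ∀ {u v} {ws : List A} → Unique ws → u ∈ ws →
                 ∑[ w ∈ ws ] (𝟙 (u ≟ w) * 𝟙 (v ≟ w)) ≡ 𝟙 (u ≟ v)
  ∑-𝟙-≟-*-𝟙-≟ {u} {v} {ws} unique u∈ws with u ≟ v
  ... | yes refl = trans (∑-cong ws (λ {w} _ → 𝟙-*-𝟙 (u ≟ w))) (∑-𝟙-≟-unique unique u∈ws)
  ... | no  u≢v  =
    trans (∑-cong ws (λ {w} _ → 𝟙-≟-*-𝟙-≟-≢ u≢v w)) (trans (∑-const ws 0) (*-zeroʳ (length ws)))

length-cartesianProductWith : ∀ (h : A → B → X) (xs : List A) (ys : List B) →
  length (cartesianProductWith h xs ys) ≡ length xs * length ys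
length-cartesianProductWith h []       ys = refl
length-cartesianProductWith h (x ∷ xs) ys = begin
  length (map (h x) ys ++ cartesianProductWith h xs ys)  ≡⟨ List.length-++ (map (h x) ys) ⟩
  length (map (h x) ys) + length (cartesianProductWith h xs ys)
    ≡⟨ cong₂ _+_ (List.length-map (h x) ys) (length-cartesianProductWith h xs ys) ⟩
  length ys + length xs * length ys  ∎
  where open ≡-Reasoning

length-allFin : ∀ n → length (allFin n) ≡ n
length-allFin n = List.length-tabulate (λ i → i)

allVecs : List A → (d : ℕ) → List (Vec A d)
allVecs xs zero    = [ [] ]
allVecs xs (suc d) = cartesianProductWith _∷_ xs (allVecs xs d)

allVecs⁺ : ∀ {xs : List A} → Unique xs → ∀ d → Unique (allVecs xs d)
allVecs⁺ u zero    = All.[] ∷ []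
allVecs⁺ u (suc d) = cartesianProductWith⁺ _∷_ Vec.∷-injective u (allVecs⁺ u d)

∈-allVecs : ∀ {xs : List A} → (∀ x → x ∈ xs) → ∀ {d} (v : Vec A d) → v ∈ allVecs xs d
∈-allVecs complete []      = here refl
∈-allVecs complete (x ∷ v) = ∈-cartesianProductWith⁺ _∷_ (complete x) (∈-allVecs complete v)

allLists : List A → ℕ → List (List A)
allLists xs zero    = [ [] ]
allLists xs (suc d) = cartesianProductWith _∷_ xs (allLists xs d)

allLists⁺ : ∀ {xs : List A} → Unique xs → ∀ d → Unique (allLists xs d)
allLists⁺ u zero    = All.[] ∷ []
allLists⁺ u (suc d) = cartesianProductWith⁺ _∷_ List.∷-injective u (allLists⁺ u d)

∈-allLists : ∀ {xs : List A} → (∀ x → x ∈ xs) → (l : List A) → l ∈ allLists xs (length l)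
∈-allLists complete []      = here refl
∈-allLists complete (x ∷ l) = ∈-cartesianProductWith⁺ _∷_ (complete x) (∈-allLists complete l)

length-allLists : ∀ (xs : List A) d → length (allLists xs d) ≡ length xs ^ d
length-allLists xs zero    = refl
length-allLists xs (suc d) =
  trans (length-cartesianProductWith _∷_ xs (allLists xs d)) (cong (length xs *_) (length-allLists xs d))

-- With #P = α * β, the number (d C k) (#P)^k α^(d-k) of vectors with exactly k entries in P
-- takes the form (d C k) β^k α^d, free of truncated subtraction.
module CountByEntries {P : Pred A ℓ} (P? : Decidable P) (xs : List A) (α β : ℕ)
  (#¬P : ∑[ x ∈ xs ] 𝟙 (¬? (P? x)) ≡ α) (length-xs : length xs ≡ α * suc β) where

  #P : ∑[ x ∈ xs ] 𝟙 (P? x) ≡ α * β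
  #P = +-cancelʳ-≡ α _ _ (begin
    ∑[ x ∈ xs ] 𝟙 (P? x) + α                         ≡⟨ cong (_ +_) #¬P ⟨
    ∑[ x ∈ xs ] 𝟙 (P? x) + ∑[ x ∈ xs ] 𝟙 (¬? (P? x))  ≡⟨ ∑-+ xs _ _ ⟨
    ∑[ x ∈ xs ] (𝟙 (P? x) + 𝟙 (¬? (P? x)))            ≡⟨ ∑-cong xs (λ {x} _ → 𝟙-+-𝟙-¬ (P? x)) ⟩
    ∑[ x ∈ xs ] 1                                     ≡⟨ ∑-const xs 1 ⟩
    length xs * 1                                     ≡⟨ *-identityʳ _ ⟩
    length xs                                         ≡⟨ length-xs ⟩
    α * suc β                                         ≡⟨ *-suc α β ⟩
    α + α * β                                         ≡⟨ +-comm α _ ⟩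
    α * β + α                                         ∎)
    where open ≡-Reasoning

  vecsWith : ℕ → ℕ → ℕ
  vecsWith d k = ∑[ v ∈ allVecs xs d ] 𝟙 (count P? v ≟ⁿ k)

  vecsWithPred : ℕ → ℕ → ℕ
  vecsWithPred d zero    = 0
  vecsWithPred d (suc k) = vecsWith d k

  vecsWith-cons : ∀ d k x → ∑[ v ∈ allVecs xs d ] 𝟙 (count P? (x ∷ v) ≟ⁿ k)
                           ≡ 𝟙 (¬? (P? x)) * vecsWith d k + 𝟙 (P? x) * vecsWithPred d k
  vecsWith-cons d k x with P? x
  ... | no  _ = sym (trans (+-identityʳ _) (*-identityˡ (vecsWith d k)))
  vecsWith-cons d zero    x | yes _ = trans (∑-const (allVecs xs d) 0) (*-zeroʳ (length (allVecs xs d)))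
  vecsWith-cons d (suc k) x | yes _ = sym (*-identityˡ _)

  vecsWith-suc : ∀ d k → vecsWith (suc d) k ≡ α * vecsWith d k + α * β * vecsWithPred d k
  vecsWith-suc d k = begin
    vecsWith (suc d) k
      ≡⟨ ∑-cartesianProductWith _∷_ xs (allVecs xs d) _ ⟩
    ∑[ x ∈ xs ] ∑[ v ∈ allVecs xs d ] 𝟙 (count P? (x ∷ v) ≟ⁿ k)
      ≡⟨ ∑-cong xs (λ {x} _ → vecsWith-cons d k x) ⟩
    ∑[ x ∈ xs ] (𝟙 (¬? (P? x)) * vecsWith d k + 𝟙 (P? x) * vecsWithPred d k)
      ≡⟨ ∑-+ xs _ _ ⟩
    ∑[ x ∈ xs ] (𝟙 (¬? (P? x)) * vecsWith d k) + ∑[ x ∈ xs ] (𝟙 (P? x) * vecsWithPred d k)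
      ≡⟨ cong₂ _+_ (∑-cong xs (λ {x} _ → *-comm (𝟙 (¬? (P? x))) _))
                   (∑-cong xs (λ {x} _ → *-comm (𝟙 (P? x)) _)) ⟩
    ∑[ x ∈ xs ] (vecsWith d k * 𝟙 (¬? (P? x))) + ∑[ x ∈ xs ] (vecsWithPred d k * 𝟙 (P? x))
      ≡⟨ cong₂ _+_ (∑-*ˡ xs (vecsWith d k) _) (∑-*ˡ xs (vecsWithPred d k) _) ⟩
    vecsWith d k * ∑[ x ∈ xs ] 𝟙 (¬? (P? x)) + vecsWithPred d k * ∑[ x ∈ xs ] 𝟙 (P? x)
      ≡⟨ cong₂ _+_ (cong (vecsWith d k *_) #¬P) (cong (vecsWithPred d k *_) #P) ⟩
    vecsWith d k * α + vecsWithPred d k * (α * β)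
      ≡⟨ cong₂ _+_ (*-comm (vecsWith d k) α) (*-comm (vecsWithPred d k) _) ⟩
    α * vecsWith d k + α * β * vecsWithPred d k  ∎
    where open ≡-Reasoning

  vecsWith-closed : ∀ d k → vecsWith d k ≡ (d C k) * (β ^ k * α ^ d)
  vecsWith-closed zero    zero    = refl
  vecsWith-closed zero    (suc k) = refl
  vecsWith-closed (suc d) zero    = begin
    vecsWith (suc d) zero                   ≡⟨ vecsWith-suc d zero ⟩
    α * vecsWith d zero + α * β * 0         ≡⟨ cong (λ w → α * w + α * β * 0) (vecsWith-closed d zero) ⟩
    α * ((d C 0) * (1 * α ^ d)) + α * β * 0    ≡⟨ regroup α β (d C 0) (α ^ d) ⟩
    (d C 0) * (1 * (α * α ^ d))                ∎
    where
    open ≡-Reasoning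
    regroup : ∀ α β c αᵈ → α * (c * (1 * αᵈ)) + α * β * 0 ≡ c * (1 * (α * αᵈ))
    regroup = solve-∀
  vecsWith-closed (suc d) (suc k) = begin
    vecsWith (suc d) (suc k)
      ≡⟨ vecsWith-suc d (suc k) ⟩
    α * vecsWith d (suc k) + α * β * vecsWith d k
      ≡⟨ cong₂ (λ u w → α * u + α * β * w) (vecsWith-closed d (suc k)) (vecsWith-closed d k) ⟩
    α * ((d C suc k) * (β * β ^ k * α ^ d)) + α * β * ((d C k) * (β ^ k * α ^ d))
      ≡⟨ regroup α β (d C k) (d C suc k) (β ^ k) (α ^ d) ⟩
    (d C k + d C suc k) * (β * β ^ k * (α * α ^ d))
      ≡⟨ cong (_* (β ^ suc k * α ^ suc d)) (nCk+nC[k+1]≡[n+1]C[k+1] d k) ⟩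
    (suc d C suc k) * (β ^ suc k * α ^ suc d)  ∎
    where
    open ≡-Reasoning
    regroup : ∀ α β c c′ βᵏ αᵈ → α * (c′ * (β * βᵏ * αᵈ)) + α * β * (c * (βᵏ * αᵈ))
                             ≡ (c + c′) * (β * βᵏ * (α * αᵈ))
    regroup = solve-∀

  length-filter-count : ∀ d k → length (filter (λ v → count P? v ≟ⁿ k) (allVecs xs d)) ≡ (d C k) * (β ^ k * α ^ d)
  length-filter-count d k = trans (length-filter≡∑𝟙 _ (allVecs xs d)) (vecsWith-closed d k)

∑-*-∑ : ∀ (xs : List A) (ys : List B) (f : A → ℕ) (g : B → ℕ) →
        ∑ xs f * ∑ ys g ≡ ∑[ x ∈ xs ] ∑[ y ∈ ys ] (f x * g y)
∑-*-∑ xs ys f g = begin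
  ∑ xs f * ∑ ys g                     ≡⟨ *-comm (∑ xs f) _ ⟩
  ∑ ys g * ∑ xs f                     ≡⟨ ∑-*ˡ xs (∑ ys g) f ⟨
  ∑[ x ∈ xs ] (∑ ys g * f x)          ≡⟨ ∑-cong xs (λ {x} _ → *-comm (∑ ys g) (f x)) ⟩
  ∑[ x ∈ xs ] (f x * ∑ ys g)          ≡⟨ ∑-cong xs (λ {x} _ → ∑-*ˡ ys (f x) g) ⟨
  ∑[ x ∈ xs ] ∑[ y ∈ ys ] (f x * g y) ∎
  where open ≡-Reasoning

2mn≤m²+n² : ∀ m n → 2 * (m * n) ≤ m * m + n * n
2mn≤m²+n² zero    n       = z≤n
2mn≤m²+n² (suc m) zero    rewrite *-zeroʳ m = z≤n
2mn≤m²+n² (suc m) (suc n) =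
  subst₂ _≤_ (sym (lhs m n)) (sym (rhs m n)) (+-monoʳ-≤ (2 + 2 * m + 2 * n) (2mn≤m²+n² m n))
  where
  lhs : ∀ m n → 2 * (suc m * suc n) ≡ (2 + 2 * m + 2 * n) + 2 * (m * n)
  lhs = solve-∀
  rhs : ∀ m n → suc m * suc m + suc n * suc n ≡ (2 + 2 * m + 2 * n) + (m * m + n * n)
  rhs = solve-∀

cauchy-schwarz : ∀ (xs : List A) (f : A → ℕ) → ∑ xs f * ∑ xs f ≤ length xs * ∑[ x ∈ xs ] (f x * f x)
cauchy-schwarz xs f = *-cancelˡ-≤ 2 (begin
  2 * (∑ xs f * ∑ xs f)                                    ≡⟨ cong (2 *_) (∑-*-∑ xs xs f f) ⟩
  2 * ∑[ x ∈ xs ] ∑[ y ∈ xs ] (f x * f y)                  ≡⟨ ∑-*ˡ xs 2 _ ⟨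
  ∑[ x ∈ xs ] (2 * ∑[ y ∈ xs ] (f x * f y))                ≡⟨ ∑-cong xs (λ _ → ∑-*ˡ xs 2 _) ⟨
  ∑[ x ∈ xs ] ∑[ y ∈ xs ] (2 * (f x * f y))
    ≤⟨ ∑-mono xs (λ x → ∑-mono xs (λ y → 2mn≤m²+n² (f x) (f y))) ⟩
  ∑[ x ∈ xs ] ∑[ y ∈ xs ] (f x * f x + f y * f y)          ≡⟨ ∑-cong xs (λ _ → ∑-+ xs _ _) ⟩
  ∑[ x ∈ xs ] (∑[ y ∈ xs ] (f x * f x) + S₂)               ≡⟨ ∑-+ xs _ _ ⟩
  ∑[ x ∈ xs ] ∑[ y ∈ xs ] (f x * f x) + ∑[ x ∈ xs ] S₂
    ≡⟨ cong₂ _+_ (∑-cong xs (λ _ → ∑-const xs _)) (∑-const xs S₂) ⟩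
  ∑[ x ∈ xs ] (length xs * (f x * f x)) + length xs * S₂  ≡⟨ cong (_+ length xs * S₂) (∑-*ˡ xs (length xs) _) ⟩
  length xs * S₂ + length xs * S₂                         ≡⟨ cong (length xs * S₂ +_) (+-identityʳ _) ⟨
  2 * (length xs * S₂)                                    ∎)
  where
  open ≤-Reasoning
  S₂ : ℕ
  S₂ = ∑[ x ∈ xs ] (f x * f x)

-- Cauchy–Schwarz over the fibre sizes of K: the ordered pairs in a common fibre (the diagonal
-- and the collisions) number at least |L|²/|E|.
module Collisions {A : Set a} {B : Set b} (_≟ᴬ_ : DecidableEquality A) (_≟ᴮ_ : DecidableEquality B)
                  (K : A → B) where

  Collision? : (ab : A × A) → Dec (K (proj₁ ab) ≡ K (proj₂ ab) × ¬ proj₁ ab ≡ proj₂ ab)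
  Collision? (a , b) = (K a ≟ᴮ K b) ×-dec ¬? (a ≟ᴬ b)

  collisions : List A → List (A × A)
  collisions L = filter Collision? (cartesianProduct L L)

  𝟙-K≟K : ∀ a b → 𝟙 (K a ≟ᴮ K b) ≡ 𝟙 (Collision? (a , b)) + 𝟙 (a ≟ᴬ b)
  𝟙-K≟K a b with K a ≟ᴮ K b | a ≟ᴬ b
  ... | yes _   | yes _    = refl
  ... | yes _   | no  _    = refl
  ... | no Ka≢Ka | yes refl = ⊥-elim (Ka≢Ka refl)
  ... | no  _   | no  _    = refl

  ∑∑-𝟙-K≟K : ∀ {L} → Unique L → ∑[ a ∈ L ] ∑[ b ∈ L ] 𝟙 (K a ≟ᴮ K b) ≡ length (collisions L) + length L
  ∑∑-𝟙-K≟K {L} unique = begin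
    ∑[ a ∈ L ] ∑[ b ∈ L ] 𝟙 (K a ≟ᴮ K b)
      ≡⟨ ∑-cong L (λ _ → ∑-cong L (λ _ → 𝟙-K≟K _ _)) ⟩
    ∑[ a ∈ L ] ∑[ b ∈ L ] (𝟙 (Collision? (a , b)) + 𝟙 (a ≟ᴬ b))
      ≡⟨ ∑-cong L (λ {a} a∈L → trans (∑-+ L _ _)
           (cong (∑[ b ∈ L ] 𝟙 (Collision? (a , b)) +_) (∑-𝟙-≟-unique _≟ᴬ_ unique a∈L))) ⟩
    ∑[ a ∈ L ] (∑[ b ∈ L ] 𝟙 (Collision? (a , b)) + 1)
      ≡⟨ ∑-+ L _ _ ⟩
    ∑[ a ∈ L ] ∑[ b ∈ L ] 𝟙 (Collision? (a , b)) + ∑[ a ∈ L ] 1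
      ≡⟨ cong₂ _+_ (sym (∑-cartesianProductWith _,_ L L (𝟙 ∘ Collision?))) (∑-const L 1) ⟩
    ∑ (cartesianProduct L L) (𝟙 ∘ Collision?) + length L * 1
      ≡⟨ cong₂ _+_ (sym (length-filter≡∑𝟙 Collision? (cartesianProduct L L))) (*-identityʳ _) ⟩
    length (collisions L) + length L  ∎
    where open ≡-Reasoning

  collisions-bound : ∀ {L E} → Unique L → Unique E → (∀ {a} → a ∈ L → K a ∈ E) →
                     length L * length L ≤ length E * (length (collisions L) + length L)
  collisions-bound {L} {E} uniqueL uniqueE K∈E =
    subst₂ (λ l q → l * l ≤ length E * q) ∑-fibre ∑-fibre² (cauchy-schwarz E fibre)
    where
    fibre : B → ℕ
    fibre e = ∑[ a ∈ L ] 𝟙 (K a ≟ᴮ e)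

    ∑-fibre : ∑ E fibre ≡ length L
    ∑-fibre = begin
      ∑[ e ∈ E ] ∑[ a ∈ L ] 𝟙 (K a ≟ᴮ e)  ≡⟨ ∑-swap E L _ ⟩
      ∑[ a ∈ L ] ∑[ e ∈ E ] 𝟙 (K a ≟ᴮ e)
        ≡⟨ ∑-cong L (λ a∈L → ∑-𝟙-≟-unique _≟ᴮ_ uniqueE (K∈E a∈L)) ⟩
      ∑[ a ∈ L ] 1                         ≡⟨ ∑-const L 1 ⟩
      length L * 1                         ≡⟨ *-identityʳ _ ⟩
      length L                             ∎
      where open ≡-Reasoning

    ∑-fibre² : ∑[ e ∈ E ] (fibre e * fibre e) ≡ length (collisions L) + length L
    ∑-fibre² = begin
      ∑[ e ∈ E ] (fibre e * fibre e)
        ≡⟨ ∑-cong E (λ _ → ∑-*-∑ L L _ _) ⟩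
      ∑[ e ∈ E ] ∑[ a ∈ L ] ∑[ b ∈ L ] (𝟙 (K a ≟ᴮ e) * 𝟙 (K b ≟ᴮ e))
        ≡⟨ ∑-swap E L _ ⟩
      ∑[ a ∈ L ] ∑[ e ∈ E ] ∑[ b ∈ L ] (𝟙 (K a ≟ᴮ e) * 𝟙 (K b ≟ᴮ e))
        ≡⟨ ∑-cong L (λ _ → ∑-swap E L _) ⟩
      ∑[ a ∈ L ] ∑[ b ∈ L ] ∑[ e ∈ E ] (𝟙 (K a ≟ᴮ e) * 𝟙 (K b ≟ᴮ e))
        ≡⟨ ∑-cong L (λ a∈L → ∑-cong L (λ _ → ∑-𝟙-≟-*-𝟙-≟ _≟ᴮ_ uniqueE (K∈E a∈L))) ⟩
      ∑[ a ∈ L ] ∑[ b ∈ L ] 𝟙 (K a ≟ᴮ K b)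
        ≡⟨ ∑∑-𝟙-K≟K uniqueL ⟩
      length (collisions L) + length L  ∎
      where open ≡-Reasoning

  collisions⁺ : ∀ {L} → Unique L → Unique (collisions L)
  collisions⁺ unique = filter⁺ Collision? (cartesianProduct⁺ unique unique)

  ∈-collisions⁻ : ∀ {L a b} → (a , b) ∈ collisions L → a ∈ L × K a ≡ K b × ¬ a ≡ b
  ∈-collisions⁻ {L} ab∈ with ab∈L² , Ka≡Kb , a≢b ← ∈-filter⁻ Collision? {xs = cartesianProduct L L} ab∈
    = proj₁ (∈-cartesianProduct⁻ L L ab∈L²) , Ka≡Kb , a≢b

++-injective-length : ∀ (xs xs′ : List A) {ys ys′} → length xs ≡ length xs′ →
                      xs ++ ys ≡ xs′ ++ ys′ → xs ≡ xs′ × ys ≡ ys′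
++-injective-length []       []         _   eq = refl , eq
++-injective-length (x ∷ xs) (x′ ∷ xs′) len eq
  with xs≡xs′ , ys≡ys′ ← ++-injective-length xs xs′ (suc-injective len) (List.∷-injectiveʳ eq)
  = cong₂ _∷_ (List.∷-injectiveˡ eq) xs≡xs′ , ys≡ys′

-- Colourings of cubes

lower upper : ∀ {d} → (Vec Bool (suc d) → A) → Vec Bool d → A
lower g c = g (false ∷ c)
upper g c = g (true ∷ c)

origin : ∀ {d} → Vec Bool d
origin = replicate _ false

trues : ∀ {d} → Vec Bool d → ℕ
trues = count T?

-- Functions on the cube {false,true}ᵈ; S marks the active directions, those i with aⁱ₁ ≢ aⁱ₂.
Invariant : {A : Set} {d : ℕ} → Vec Bool d → (Vec Bool d → A) → Set
Invariant []          g = ⊤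
Invariant (false ∷ S) g = upper g ≗ lower g × Invariant S (lower g)
Invariant (true  ∷ S) g = Invariant S (lower g) × Invariant S (upper g)

Proper : {A : Set} {d : ℕ} → Vec Bool d → (Vec Bool d → A) → Set
Proper []          g = ⊤
Proper (false ∷ S) g = Proper S (lower g)
Proper (true  ∷ S) g = Proper S (lower g) × (∀ c → ¬ lower g c ≡ upper g c)

module CubeCode (p : ℕ) where

  -- j as seen from a neighbour i ≢ j; the value 0 for i ≡ j is junk.
  relative : Fin (2 + p) → Fin (2 + p) → Fin (1 + p)
  relative i j with i ≟ᶠ j
  ... | yes _   = zero
  ... | no i≢j = punchOut i≢j

  relative-injective : ∀ {i j j′} → ¬ i ≡ j → ¬ i ≡ j′ → relative i j ≡ relative i j′ → j ≡ j′
  relative-injective {i} {j} {j′} i≢j i≢j′ eq with i ≟ᶠ j | i ≟ᶠ j′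
  ... | yes i≡j | _        = ⊥-elim (i≢j i≡j)
  ... | no  _   | yes i≡j′ = ⊥-elim (i≢j′ i≡j′)
  ... | no  i≢j | no i≢j′  = punchOut-injective i≢j i≢j′ eq

  differences : ∀ {d} (S : Vec Bool d) → (g h : Vec Bool d → Fin (2 + p)) → List (Fin (1 + p))
  differences []          g h = [ relative (g []) (h []) ]
  differences (false ∷ S) g h = differences S (lower g) (lower h)
  differences (true  ∷ S) g h = differences S (lower g) (lower h) ++ differences S (upper g) (upper h)

  -- Each vertex of the upper face in an active direction is recorded relative to its lower
  -- neighbour, so a proper g is recovered from g origin and code S g.
  code : ∀ {d} (S : Vec Bool d) → (Vec Bool d → Fin (2 + p)) → List (Fin (1 + p))
  code []          g = []
  code (false ∷ S) g = code S (lower g)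
  code (true  ∷ S) g = code S (lower g) ++ differences S (lower g) (upper g)

  length-differences : ∀ {d} (S : Vec Bool d) g h → length (differences S g h) ≡ 2 ^ trues S
  length-differences []          g h = refl
  length-differences (false ∷ S) g h = length-differences S (lower g) (lower h)
  length-differences (true  ∷ S) g h = begin
    length (differences S (lower g) (lower h) ++ differences S (upper g) (upper h))
      ≡⟨ List.length-++ (differences S (lower g) (lower h)) ⟩
    length (differences S (lower g) (lower h)) + length (differences S (upper g) (upper h))
      ≡⟨ cong₂ _+_ (length-differences S _ _) (length-differences S _ _) ⟩
    2 ^ trues S + 2 ^ trues S
      ≡⟨ cong (2 ^ trues S +_) (+-identityʳ _) ⟨
    2 ^ suc (trues S)  ∎
    where open ≡-Reasoning

  length-code : ∀ {d} (S : Vec Bool d) g → length (code S g) ≡ 2 ^ trues S ∸ 1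
  length-code []          g = refl
  length-code (false ∷ S) g = length-code S (lower g)
  length-code (true  ∷ S) g = begin
    length (code S (lower g) ++ differences S (lower g) (upper g))
      ≡⟨ List.length-++ (code S (lower g)) ⟩
    length (code S (lower g)) + length (differences S (lower g) (upper g))
      ≡⟨ cong₂ _+_ (length-code S _) (length-differences S _ _) ⟩
    (2 ^ trues S ∸ 1) + 2 ^ trues S
      ≡⟨ +-∸-comm (2 ^ trues S) (m^n>0 2 (trues S)) ⟨
    (2 ^ trues S + 2 ^ trues S) ∸ 1
      ≡⟨ cong (λ m → 2 ^ trues S + m ∸ 1) (+-identityʳ _) ⟨
    2 ^ suc (trues S) ∸ 1  ∎
    where open ≡-Reasoning

  differences-injective : ∀ {d} (S : Vec Bool d) {g g′ h h′} → g ≗ g′ →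
    (∀ c → ¬ g c ≡ h c) → (∀ c → ¬ g′ c ≡ h′ c) → Invariant S h → Invariant S h′ →
    differences S g h ≡ differences S g′ h′ → h ≗ h′
  differences-injective [] {g} {g′} {h} {h′} g≗g′ g≢h g′≢h′ _ _ eq [] =
    relative-injective (g≢h []) (subst (λ x → ¬ x ≡ h′ []) (sym (g≗g′ [])) (g′≢h′ []))
      (trans (List.∷-injectiveˡ eq) (cong (λ x → relative x (h′ [])) (sym (g≗g′ []))))
  differences-injective (false ∷ S) {h = h} {h′} g≗g′ g≢h g′≢h′ (h↑≗h↓ , inv) (h′↑≗h′↓ , inv′) eq =
    faces
    where
    lower-faces : lower h ≗ lower h′
    lower-faces =
      differences-injective S (g≗g′ ∘ (false ∷_)) (g≢h ∘ (false ∷_)) (g′≢h′ ∘ (false ∷_)) inv inv′ eq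
    faces : h ≗ h′
    faces (false ∷ c) = lower-faces c
    faces (true  ∷ c) = trans (h↑≗h↓ c) (trans (lower-faces c) (sym (h′↑≗h′↓ c)))
  differences-injective (true ∷ S) {g} {g′} {h} {h′} g≗g′ g≢h g′≢h′ (invₗ , invᵤ) (invₗ′ , invᵤ′) eq =
    faces
    where
    halves : differences S (lower g) (lower h) ≡ differences S (lower g′) (lower h′)
           × differences S (upper g) (upper h) ≡ differences S (upper g′) (upper h′)
    halves = ++-injective-length (differences S (lower g) (lower h)) (differences S (lower g′) (lower h′))
               (trans (length-differences S _ _) (sym (length-differences S _ _))) eq
    faces : h ≗ h′
    faces (false ∷ c) =
      differences-injective S (g≗g′ ∘ (false ∷_)) (g≢h ∘ (false ∷_)) (g′≢h′ ∘ (false ∷_))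
        invₗ invₗ′ (proj₁ halves) c
    faces (true  ∷ c) =
      differences-injective S (g≗g′ ∘ (true ∷_)) (g≢h ∘ (true ∷_)) (g′≢h′ ∘ (true ∷_))
        invᵤ invᵤ′ (proj₂ halves) c

  code-injective : ∀ {d} (S : Vec Bool d) {g g′} → Invariant S g → Invariant S g′ → Proper S g → Proper S g′ →
                   g origin ≡ g′ origin → code S g ≡ code S g′ → g ≗ g′
  code-injective [] _ _ _ _ g₀≡g′₀ _ [] = g₀≡g′₀
  code-injective (false ∷ S) {g} {g′} (g↑≗g↓ , inv) (g′↑≗g′↓ , inv′) proper proper′ g₀≡g′₀ eq = faces
    where
    lower-faces : lower g ≗ lower g′
    lower-faces = code-injective S inv inv′ proper proper′ g₀≡g′₀ eq
    faces : g ≗ g′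
    faces (false ∷ c) = lower-faces c
    faces (true  ∷ c) = trans (g↑≗g↓ c) (trans (lower-faces c) (sym (g′↑≗g′↓ c)))
  code-injective (true ∷ S) {g} {g′} (invₗ , invᵤ) (invₗ′ , invᵤ′) (properₗ , g↓≢g↑) (properₗ′ , g′↓≢g′↑)
                 g₀≡g′₀ eq = faces
    where
    halves : code S (lower g) ≡ code S (lower g′)
           × differences S (lower g) (upper g) ≡ differences S (lower g′) (upper g′)
    halves = ++-injective-length (code S (lower g)) (code S (lower g′))
               (trans (length-code S _) (sym (length-code S _))) eq
    lower-faces : lower g ≗ lower g′
    lower-faces = code-injective S invₗ invₗ′ properₗ properₗ′ g₀≡g′₀ (proj₁ halves)
    faces : g ≗ g′
    faces (false ∷ c) = lower-faces c
    faces (true  ∷ c) = differences-injective S lower-faces g↓≢g↑ g′↓≢g′↑ invᵤ invᵤ′ (proj₂ halves) c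

-- Latin hypercubes

Distinct? : ∀ {n} (q : Fin n × Fin n) → Dec (¬ proj₁ q ≡ proj₂ q)
Distinct? (i , j) = ¬? (i ≟ᶠ j)

directions : ∀ {d n} → Pairs d n → Vec Bool d
directions []            = []
directions ((x , y) ∷ a) = does (¬? (x ≟ᶠ y)) ∷ directions a

trues-directions : ∀ {d n} (a : Pairs d n) → trues (directions a) ≡ count Distinct? a
trues-directions []            = refl
trues-directions ((x , y) ∷ a) with x ≟ᶠ y
... | yes _ = trues-directions a
... | no  _ = cong suc (trues-directions a)

select-invariant : ∀ {d n} {A : Set} (a : Pairs d n) (Q : Index d n → A) → Invariant (directions a) (Q ∘ select a)
select-invariant []            Q = tt
select-invariant ((x , y) ∷ a) Q with x ≟ᶠ y
... | yes refl = (λ _ → refl) , select-invariant a (Q ∘ (x ∷_))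
... | no  _    = select-invariant a (Q ∘ (x ∷_)) , select-invariant a (Q ∘ (y ∷_))

latin-slice : ∀ {d n} {Q : Array (suc d) n} → IsLatinHypercube Q → ∀ x → IsLatinHypercube (Q ∘ (x ∷_))
latin-slice latin x α β (i , αᵢ≢βᵢ , α≡β-elsewhere) = latin (x ∷ α) (x ∷ β) (suc i , αᵢ≢βᵢ , agree)
  where
  agree : ∀ j → ¬ j ≡ suc i → lookup (x ∷ α) j ≡ lookup (x ∷ β) j
  agree zero    _       = refl
  agree (suc j) j≢suc-i = α≡β-elsewhere j (j≢suc-i ∘ cong suc)

latin-first : ∀ {d n} {Q : Array (suc d) n} → IsLatinHypercube Q →
              ∀ {x y} (α : Index d n) → ¬ x ≡ y → ¬ Q (x ∷ α) ≡ Q (y ∷ α)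
latin-first latin α x≢y = latin _ _ (zero , x≢y , agree)
  where
  agree : ∀ j → ¬ j ≡ zero → lookup (_ ∷ α) j ≡ lookup (_ ∷ α) j
  agree zero    j≢zero = ⊥-elim (j≢zero refl)
  agree (suc j) _      = refl

select-proper : ∀ {d n} {Q : Array d n} → IsLatinHypercube Q → (a : Pairs d n) → Proper (directions a) (Q ∘ select a)
select-proper latin []            = tt
select-proper latin ((x , y) ∷ a) with x ≟ᶠ y
... | yes _   = select-proper (latin-slice latin x) a
... | no  x≢y = select-proper (latin-slice latin x) a , λ c → latin-first latin (select a c) x≢y

module Keys (p : ℕ) where
  open CubeCode p

  Key : ℕ → Set
  Key d = Vec Bool d × Fin (2 + p) × List (Fin (1 + p))

  key : ∀ {d} → Array d (2 + p) → Pairs d (2 + p) → Key d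
  key Q a = directions a , Q (select a origin) , code (directions a) (Q ∘ select a)

  equal-keys⇒cuboctahedron : ∀ {d} {Q : Array d (2 + p)} → IsLatinHypercube Q →
                             ∀ {a b} → key Q a ≡ key Q b → IsCuboctahedron Q (a , b)
  equal-keys⇒cuboctahedron {d} {Q} latin {a} {b} eq =
    code-injective (directions a)
      (select-invariant a Q) (along-directions Invariant (select-invariant b Q))
      (select-proper latin a) (along-directions Proper (select-proper latin b))
      (cong (proj₁ ∘ proj₂) eq)
      (trans (cong (proj₂ ∘ proj₂) eq) (along-directions (λ S g → code (directions b) g ≡ code S g) refl))
    where
    along-directions : (R : Vec Bool d → (Vec Bool d → Fin (2 + p)) → Set) →
                       R (directions b) (Q ∘ select b) → R (directions a) (Q ∘ select b)
    along-directions R = subst (λ S → R S (Q ∘ select b)) (sym (cong proj₁ eq))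

collision-arithmetic : ∀ e l x t → e * t ≤ l → l * l ≤ e * (x + l) → e * (t * (t ∸ 1)) ≤ x
collision-arithmetic e        l x zero    _     _    = subst (_≤ x) (sym (*-zeroʳ e)) z≤n
collision-arithmetic zero     l x (suc t) _     _    = z≤n
collision-arithmetic (suc e′) l x (suc t) et≤l l²≤ex+el = *-cancelˡ-≤ e (begin
  e * (e * (suc t * t))  ≡⟨ rearrange e t ⟩
  e * t * (e * suc t)    ≤⟨ *-monoʳ-≤ (e * t) et≤l ⟩
  e * t * l              ≤⟨ etl≤ex ⟩
  e * x                  ∎)
  where
  open ≤-Reasoning
  e : ℕ
  e = suc e′
  rearrange : ∀ e t → e * (e * (suc t * t)) ≡ e * t * (e * suc t)
  rearrange = solve-∀
  expand : ∀ e t l → e * t * l + e * l ≡ e * suc t * l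
  expand = solve-∀
  etl≤ex : e * t * l ≤ e * x
  etl≤ex = +-cancelʳ-≤ (e * l) _ _ (begin
    e * t * l + e * l  ≡⟨ expand e t l ⟩
    e * suc t * l      ≤⟨ *-monoˡ-≤ l et≤l ⟩
    l * l              ≤⟨ l²≤ex+el ⟩
    e * (x + l)        ≡⟨ *-distribˡ-+ e x l ⟩
    e * x + e * l      ∎)

div-*-≤ : ∀ m n → (m div n) * n ≤ m
div-*-≤ m zero    = z≤n
div-*-≤ m (suc n) = m/n*n≤m m (suc n)

n<2^n : ∀ n → n < 2 ^ n
n<2^n zero    = s≤s z≤n
n<2^n (suc n) = +-mono-≤ (m^n>0 2 n) (subst (suc n ≤_) (sym (+-identityʳ _)) (n<2^n n))

2^k∸1≡[2^k∸[k+1]]+k : ∀ k → 2 ^ k ∸ 1 ≡ (2 ^ k ∸ (k + 1)) + k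
2^k∸1≡[2^k∸[k+1]]+k k = begin
  2 ^ k ∸ 1                ≡⟨ m∸n+n≡m (∸-monoˡ-≤ 1 (n<2^n k)) ⟨
  (2 ^ k ∸ 1) ∸ k + k      ≡⟨ cong (_+ k) (∸-+-assoc (2 ^ k) 1 k) ⟩
  2 ^ k ∸ (1 + k) + k      ≡⟨ cong (λ m → 2 ^ k ∸ m + k) (+-comm 1 k) ⟩
  (2 ^ k ∸ (k + 1)) + k    ∎
  where open ≡-Reasoning

allPairs : ∀ n → List (Fin n × Fin n)
allPairs n = cartesianProduct (allFin n) (allFin n)

#equal-pairs : ∀ n → ∑[ q ∈ allPairs n ] 𝟙 (¬? (Distinct? q)) ≡ n
#equal-pairs n = begin
  ∑[ q ∈ allPairs n ] 𝟙 (¬? (Distinct? q))           ≡⟨ ∑-cartesianProductWith _,_ (allFin n) (allFin n) _ ⟩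
  ∑[ i ∈ allFin n ] ∑[ j ∈ allFin n ] 𝟙 (¬? (¬? (i ≟ᶠ j)))
    ≡⟨ ∑-cong (allFin n) (λ {i} i∈ → trans (∑-cong (allFin n) (λ {j} _ → 𝟙-¬¬ (i ≟ᶠ j)))
                                        (∑-𝟙-≟-unique _≟ᶠ_ (allFin⁺ n) i∈)) ⟩
  ∑[ i ∈ allFin n ] 1                                ≡⟨ ∑-const (allFin n) 1 ⟩
  length (allFin n) * 1                              ≡⟨ *-identityʳ _ ⟩
  length (allFin n)                                  ≡⟨ length-allFin n ⟩
  n                                                  ∎
  where open ≡-Reasoning

length-allPairs : ∀ n → length (allPairs n) ≡ n * n
length-allPairs n = trans (length-cartesianProductWith _,_ (allFin n) (allFin n)) (cong₂ _*_ (length-allFin n) (length-allFin n))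

pairVectors : ∀ d n k → List (Pairs d n)
pairVectors d n k = filter (λ a → count Distinct? a ≟ⁿ k) (allVecs (allPairs n) d)

length-pairVectors : ∀ d p k → length (pairVectors d (2 + p) k) ≡ (d C k) * ((1 + p) ^ k * (2 + p) ^ d)
length-pairVectors d p k = CountByEntries.length-filter-count Distinct? (allPairs (2 + p)) (2 + p) (1 + p)
                             (#equal-pairs (2 + p)) (length-allPairs (2 + p)) d k

booleans : List Bool
booleans = true ∷ false ∷ []

booleans⁺ : Unique booleans
booleans⁺ = ((λ ()) All.∷ All.[]) ∷ All.[] ∷ []

∈-booleans : ∀ b → b ∈ booleans
∈-booleans true  = here refl
∈-booleans false = there (here refl)

directionVectors : ∀ d k → List (Vec Bool d)
directionVectors d k = filter (λ S → trues S ≟ⁿ k) (allVecs booleans d)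

length-directionVectors : ∀ d k → length (directionVectors d k) ≡ d C k
length-directionVectors d k = begin
  length (directionVectors d k)      ≡⟨ CountByEntries.length-filter-count T? booleans 1 1 refl refl d k ⟩
  (d C k) * (1 ^ k * 1 ^ d)          ≡⟨ cong₂ (λ u v → (d C k) * (u * v)) (^-zeroˡ k) (^-zeroˡ d) ⟩
  (d C k) * 1                        ≡⟨ *-identityʳ _ ⟩
  d C k                              ∎
  where open ≡-Reasoning

module Cuboctahedra (p d′ k : ℕ) (Q : Array (suc d′) (2 + p)) (latin : IsLatinHypercube Q) where
  open CubeCode p
  open Keys p
  open Collisions (Vec.≡-dec (×-≡-dec _≟ᶠ_ _≟ᶠ_))
                  (×-≡-dec (Vec.≡-dec _≟ᵇ_) (×-≡-dec _≟ᶠ_ (List.≡-dec _≟ᶠ_))) (key Q)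
    public using (collisions; collisions⁺; ∈-collisions⁻; collisions-bound)

  d n m M : ℕ
  d = suc d′
  n = 2 + p
  m = 1 + p
  M = 2 ^ k ∸ 1

  pairs : List (Pairs d n)
  pairs = pairVectors d n k

  keySpace : List (Key d)
  keySpace = cartesianProduct (directionVectors d k) (cartesianProduct (allFin n) (allLists (allFin m) M))

  keySpace⁺ : Unique keySpace
  keySpace⁺ = cartesianProduct⁺ (filter⁺ _ (allVecs⁺ booleans⁺ d))
                                (cartesianProduct⁺ (allFin⁺ n) (allLists⁺ (allFin⁺ m) M))

  length-keySpace : length keySpace ≡ (d C k) * (n * m ^ M)
  length-keySpace = begin
    length keySpace
      ≡⟨ length-cartesianProductWith _,_ (directionVectors d k) _ ⟩
    length (directionVectors d k) * length (cartesianProduct (allFin n) (allLists (allFin m) M))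
      ≡⟨ cong₂ _*_ (length-directionVectors d k) (length-cartesianProductWith _,_ (allFin n) (allLists (allFin m) M)) ⟩
    (d C k) * (length (allFin n) * length (allLists (allFin m) M))
      ≡⟨ cong₂ (λ u v → (d C k) * (u * v)) (length-allFin n) (length-allLists (allFin m) M) ⟩
    (d C k) * (n * length (allFin m) ^ M)
      ≡⟨ cong (λ u → (d C k) * (n * u ^ M)) (length-allFin m) ⟩
    (d C k) * (n * m ^ M)  ∎
    where open ≡-Reasoning

  key∈keySpace : ∀ {a} → a ∈ pairs → key Q a ∈ keySpace
  key∈keySpace {a} a∈pairs =
    ∈-cartesianProduct⁺ (∈-filter⁺ _ (∈-allVecs ∈-booleans (directions a)) trues≡k)
      (∈-cartesianProduct⁺ (∈-allFin _)
        (subst (λ l → code (directions a) (Q ∘ select a) ∈ allLists (allFin m) l) length-code≡M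
               (∈-allLists ∈-allFin _)))
    where
    trues≡k : trues (directions a) ≡ k
    trues≡k = trans (trues-directions a) (proj₂ (∈-filter⁻ _ {xs = allVecs (allPairs n) d} a∈pairs))
    length-code≡M : length (code (directions a) (Q ∘ select a)) ≡ M
    length-code≡M = trans (length-code (directions a) _) (cong (λ t → 2 ^ t ∸ 1) trues≡k)

  collisions-are-cuboctahedra : All (IsNonDegCuboOfDim Q k) (collisions pairs)
  collisions-are-cuboctahedra = All.tabulate λ { {a , b} ab∈ →
    let a∈pairs , Ka≡Kb , a≢b = ∈-collisions⁻ ab∈ in
    equal-keys⇒cuboctahedron latin Ka≡Kb ,
    proj₂ (∈-filter⁻ _ {xs = allVecs (allPairs n) d} a∈pairs) ,
    a≢b }

  pairs⁺ : Unique pairs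
  pairs⁺ = filter⁺ _ (allVecs⁺ (cartesianProduct⁺ (allFin⁺ n) (allFin⁺ n)) d)

  keySpace*r≤pairs : length keySpace * r d n k ≤ length pairs
  keySpace*r≤pairs = begin
    length keySpace * r d n k                      ≡⟨ cong (_* r d n k) length-keySpace ⟩
    (d C k) * (n * m ^ M) * r d n k                ≡⟨ cong (λ t → (d C k) * (n * t) * r d n k) m^M≡m^e*m^k ⟩
    (d C k) * (n * (m ^ e * m ^ k)) * r d n k      ≡⟨ rearrange (d C k) n (m ^ e) (m ^ k) (r d n k) ⟩
    (d C k) * (m ^ k * (n * (r d n k * m ^ e)))    ≤⟨ *-monoʳ-≤ (d C k) (*-monoʳ-≤ (m ^ k) (*-monoʳ-≤ n
                                                        (div-*-≤ (n ^ d′) (m ^ e)))) ⟩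
    (d C k) * (m ^ k * n ^ d)                      ≡⟨ length-pairVectors d p k ⟨
    length pairs                                   ∎
    where
    open ≤-Reasoning
    e : ℕ
    e = 2 ^ k ∸ (k + 1)
    m^M≡m^e*m^k : m ^ M ≡ m ^ e * m ^ k
    m^M≡m^e*m^k = trans (cong (m ^_) (2^k∸1≡[2^k∸[k+1]]+k k)) (^-distribˡ-+-* m e k)
    rearrange : ∀ c n mᵉ mᵏ r → c * (n * (mᵉ * mᵏ)) * r ≡ c * (mᵏ * (n * (r * mᵉ)))
    rearrange = solve-∀

  many-collisions : (d C k) * n * ((n ∸ d) ^ M) * (r d n k * (r d n k ∸ 1)) ≤ length (collisions pairs)
  many-collisions = begin
    (d C k) * n * ((n ∸ d) ^ M) * (r d n k * (r d n k ∸ 1))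
      ≤⟨ *-monoˡ-≤ (r d n k * (r d n k ∸ 1)) ≤length-keySpace ⟩
    length keySpace * (r d n k * (r d n k ∸ 1))
      ≤⟨ collision-arithmetic (length keySpace) (length pairs) _ (r d n k)
           keySpace*r≤pairs (collisions-bound pairs⁺ keySpace⁺ key∈keySpace) ⟩
    length (collisions pairs)  ∎
    where
    open ≤-Reasoning
    ≤length-keySpace : (d C k) * n * ((n ∸ d) ^ M) ≤ length keySpace
    ≤length-keySpace = begin
      (d C k) * n * ((n ∸ d) ^ M)  ≡⟨ *-assoc (d C k) n _ ⟩
      (d C k) * (n * (n ∸ d) ^ M)  ≤⟨ *-monoʳ-≤ (d C k) (*-monoʳ-≤ n (^-monoˡ-≤ M (m∸n≤m m d′))) ⟩
      (d C k) * (n * m ^ M)        ≡⟨ length-keySpace ⟨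
      length keySpace              ∎

proposition6 : (d n k : ℕ) → 3 ≤ d → d < n → 2 ≤ k → k ≤ n →
    (Q : Array d n) → IsLatinHypercube Q →
    Σ (List (CuboTuple d n)) (λ cs →
      Unique cs × All (IsNonDegCuboOfDim Q k) cs ×
      (d C k) * n * ((n ∸ d) ^ ((2 ^ k) ∸ 1)) * (r d n k * (r d n k ∸ 1)) ≤ length cs)
proposition6 zero     _             _ () _         _ _ _ _
proposition6 (suc d′) zero          _ _  ()        _ _ _ _
proposition6 (suc d′) (suc zero)    _ _  (s≤s ())  _ _ _ _
proposition6 (suc d′) (suc (suc p)) k _  _         _ _ Q latin =
  collisions pairs , collisions⁺ pairs⁺ , collisions-are-cuboctahedra , many-collisions
  where open Cuboctahedra p d′ k Q latin
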